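{- Let $\alpha$ be a scalar umbra, $\gamma$ a scalar umbra provided with a compositional inverse, and $\sigma_x$ a polynomial umbra. Then $\sigma_x$ is a Sheffer umbra for $(\alpha,\gamma)$ if and only if $\sigma_{\alpha+x.u}$ is the umbra associated to $\gamma$, i.e. $\sigma_{\alpha+x.u}\equiv x.\gamma^{*}$.
   Context: Setting (classical umbral calculus). $R$ is a commutative integral domain whose quotient field has characteristic $0$. Umbrae are symbols with a linear evaluation $E$, $E[1]=1$, multiplicative on products of powers of pairwise distinct umbrae. Moments $a_n=E[\alpha^n]$, g.f. $f(\alpha,t)=\sum a_nt^n/n!$; similarity $\equiv$ means equal moments. Saturation: umbral expressions denote auxiliary umbrae determined up to similarity by their g.f.; distinct ones in a sum are uncorrelated. Special umbrae: unity $u$ ($e^t$), Bell $\beta$ ($\exp(e^t-1)$). G.f. rules: $f(\alpha+\gamma,t)=f(\alpha,t)f(\gamma,t)$; for a scalar $c$ (integer or indeterminate) $f(c.\alpha,t)=f(\alpha,t)^c$ (so $x.u$ has moments $x^n$); $f(\gamma.\alpha,t)=f(\gamma,\log f(\alpha,t))$; dot-products associate. $\gamma$ is provided with a compositional inverse if $E[\gamma]\ne0$ and $f(\gamma,t)-1$ has a compositional inverse series $h_\gamma$; then $\gamma^{<-1>}$ has g.f. $1+h_\gamma$, and $\gamma^*=\beta.\gamma^{<-1>}$ has g.f. $\exp(h_\gamma)$; the umbra associated to $\gamma$ is $x.\gamma^*$ (g.f. $\exp(xh_\gamma(t))$). Scalar umbra: moments in $R$. A polynomial umbra $\sigma_x$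 has moments $s_n(x)=\sum_ks_{n,k}x^k\in R[x]$, $s_0=1$, $\deg s_n=n$; for an umbra $\zeta$ (possibly polynomial), $\sigma_\zeta$ has moments $E[s_n(\zeta)]=\sum_k s_{n,k}E[\zeta^k]$. $\sigma_x$ is a Sheffer umbra for $(\alpha,\gamma)$ if $\sigma_x\equiv(-1.\alpha+x.u).\gamma^*$. -}

module Defs where

open import Level using (_⊔_)
open import Algebra.Bundles using (CommutativeRing)
open import Data.Nat using (ℕ; zero; suc; _∸_; _<_)
open import Data.Nat.Combinatorics using (_C_)
open import Data.Product using (_×_)
open import Data.Sum using (_⊎_)
open import Relation.Nullary using (¬_)

-- Umbral calculus over a commutative ring R, modelled through moment
-- sequences (umbrae are determined up to similarity by their moments,
-- i.e. by their exponential generating functions).  Every generating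
-- function  F(t) = Σ F_n t^n / n!  is represented by its sequence of
-- (exponential) coefficients n ↦ F_n; all operations below are the
-- division-free coefficient formulas of the corresponding operations on
-- exponential generating functions.
module Umbral {c ℓ} (R : CommutativeRing c ℓ) where
  open CommutativeRing R renaming (Carrier to A) hiding (zero)

  natR : ℕ → A
  natR zero = 0#
  natR (suc n) = 1# + natR n

  IsIntegralDomainChar0 : Set (c ⊔ ℓ)
  IsIntegralDomainChar0 =
    (¬ (1# ≈ 0#)) ×
    (∀ a b → a * b ≈ 0# → (a ≈ 0#) ⊎ (b ≈ 0#)) ×
    (∀ n → ¬ (natR (suc n) ≈ 0#))

  sumWith : {X : Set c} → (X → X → X) → ℕ → (ℕ → X) → X
  sumWith _⊕_ zero f = f zero
  sumWith _⊕_ (suc n) f = sumWith _⊕_ n f ⊕ f (suc n)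

  -- Polynomials in the indeterminate x, as coefficient sequences
  -- (k ↦ coefficient of x^k); equality is coefficientwise.
  Poly : Set c
  Poly = ℕ → A

  _≈P_ : Poly → Poly → Set ℓ
  p ≈P q = ∀ k → p k ≈ q k

  constP : A → Poly
  constP a zero = a
  constP a (suc k) = 0#

  0P 1P : Poly
  0P = constP 0#
  1P = constP 1#

  X : Poly
  X zero = 0#
  X (suc zero) = 1#
  X (suc (suc k)) = 0#

  _+P_ : Poly → Poly → Poly
  (p +P q) k = p k + q k

  _*P_ : Poly → Poly → Poly
  (p *P q) n = sumWith _+_ n (λ i → p i * q (n ∸ i))

  _·P_ : A → Poly → Poly
  (a ·P p) k = a * p k

  sumP : ℕ → (ℕ → Poly) → Poly
  sumP = sumWith _+P_

  -- Moment sequences with moments in R[x]  (n ↦ E[ν^n])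
  Seq : Set c
  Seq = ℕ → Poly

  _≡ᵤ_ : Seq → Seq → Set ℓ
  μ ≡ᵤ ν = ∀ n k → μ n k ≈ ν n k

  lift : (ℕ → A) → Seq
  lift a n = constP (a n)

  choose : ℕ → ℕ → A
  choose n k = natR (n C k)

  -- f(ν + μ, t) = f(ν, t) f(μ, t)   (binomial convolution)
  sumU : Seq → Seq → Seq
  sumU μ ν n = sumP n (λ k → choose n k ·P (μ k *P ν (n ∸ k)))

  -- partial Bell polynomials: e.g.f. of g(t)^k / k!  (g_0 ignored)
  bellB : Seq → ℕ → ℕ → Poly
  bellB g zero zero = 1P
  bellB g zero (suc n) = 0P
  bellB g (suc k) zero = 0P
  bellB g (suc k) (suc n) =
    sumP n (λ j → choose n j ·P (g (suc j) *P bellB g k (n ∸ j)))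

  -- composition  F(G(t))  of e.g.f.'s, for G with zero constant term
  compose : Seq → Seq → Seq
  compose F G n = sumP n (λ k → F k *P bellB G k n)

  minusOne : Seq → Seq
  minusOne F zero = 0P
  minusOne F (suc n) = F (suc n)

  -- exponential coefficients of log(1+s): L_0 = 0, L_(k+1) = (-1)^k k!
  logCoeff : ℕ → A
  logCoeff zero = 0#
  logCoeff (suc zero) = 1#
  logCoeff (suc (suc k)) = - (natR (suc k) * logCoeff (suc k))

  -- exp(G(t)) and log(F(t)) for G_0 = 0, F_0 = 1
  expS : Seq → Seq
  expS G = compose (λ _ → 1P) G

  logS : Seq → Seq
  logS F = compose (lift logCoeff) (minusOne F)

  -- c.μ  for a scalar c (integer or the indeterminate x):  f(μ,t)^c
  dotScalar : Poly → Seq → Seq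
  dotScalar p μ = expS (λ n → p *P logS μ n)

  -- ν.μ :  f(ν.μ, t) = f(ν, log f(μ, t))
  dotU : Seq → Seq → Seq
  dotU ν μ = compose ν (logS μ)

  -- unity umbra u (g.f. e^t) and Bell umbra β (g.f. exp(e^t - 1))
  unity : Seq
  unity n = 1P

  bell : Seq
  bell = expS (minusOne unity)

  -- x.u  (moments x^n)
  xu : Seq
  xu = dotScalar X unity

  negU : Seq → Seq
  negU μ = dotScalar (constP (- 1#)) μ

  IsScalarUmbra : (ℕ → A) → Set ℓ
  IsScalarUmbra a = a zero ≈ 1#

  tSeq : Seq
  tSeq zero = 0P
  tSeq (suc zero) = 1P
  tSeq (suc (suc n)) = 0P

  IsCompInverse : (ℕ → A) → (ℕ → A) → Set ℓ
  IsCompInverse g h =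
    (h zero ≈ 0#) ×
    (compose (minusOne (lift g)) (lift h) ≡ᵤ tSeq) ×
    (compose (lift h) (minusOne (lift g)) ≡ᵤ tSeq)

  HasCompInverse : (ℕ → A) → (ℕ → A) → Set ℓ
  HasCompInverse g h = (¬ (g (suc zero) ≈ 0#)) × IsCompInverse g h

  gammaInv : (ℕ → A) → Seq
  gammaInv h zero = 1P
  gammaInv h (suc n) = constP (h (suc n))

  gammaStar : (ℕ → A) → Seq
  gammaStar h = dotU bell (gammaInv h)

  associated : (ℕ → A) → Seq
  associated h = dotScalar X (gammaStar h)

  -- Polynomial umbrae σ_x, moments s_n(x) = Σ_k s n k x^k

  IsPolynomialUmbra : Seq → Set ℓ
  IsPolynomialUmbra s =
    (s zero ≈P 1P) ×
    (∀ n k → n < k → s n k ≈ 0#) ×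
    (∀ n → ¬ (s n n ≈ 0#))

  -- σ_ζ : moments E[s_n(ζ)] = Σ_k s_{n,k} E[ζ^k]   (deg s_n = n)
  evalAt : Seq → Seq → Seq
  evalAt s ζ n = sumP n (λ k → s n k ·P ζ k)

  IsSheffer : (ℕ → A) → (ℕ → A) → Seq → Set ℓ
  IsSheffer a h s = s ≡ᵤ dotU (sumU (negU (lift a)) xu) (gammaStar h)

-- Substituting an umbra into a polynomial umbra, σ ↦ σ_ζ, is associative and has x.u as a unit.
-- Substituting -1.α + x.u into α + x.u, or conversely, gives x.u, because f(α,t) f(-1.α,t) = 1;
-- so σ ↦ σ_{α+x.u} is invertible with inverse σ ↦ σ_{-1.α+x.u}.  By definition a Sheffer umbra is
-- (-1.α + x.u).γ*, which is the associated umbra x.γ* with -1.α + x.u substituted for x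
-- (ν.μ ≡ (x.μ)_ν).

module Submission where

open import Defs
open import Algebra.Bundles using (CommutativeRing)
open import Data.Nat using (ℕ)
open import Function.Bundles using (_⇔_; mk⇔)
open import Data.Product using (_,_)
open import Relation.Binary.Bundles using (Setoid)

module _ where
  open import Data.Nat
  open import Data.Nat.Properties
  open import Data.Nat.Combinatorics
  open import Data.Nat.DivMod
  open import Relation.Binary.PropositionalEquality
  open import Data.Nat.Tactic.RingSolver
  open ≡-Reasoning

  nCk*k!*[n∸k]!≡n! : ∀ {n k} → k ≤ n → (n C k) * (k ! * (n ∸ k) !) ≡ n !
  nCk*k!*[n∸k]!≡n! {n} {k} k≤n =
    trans (cong (_* (k ! * (n ∸ k) !)) (nCk≡n!/k![n-k]! k≤n)) (m/n*n≡m {{k !* (n ∸ k) !≢0}} (k![n∸k]!∣n! k≤n))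

  nC[m+i]*[m+i]Cm≡nCm*[n∸m]Ci : ∀ n m i → m + i ≤ n →
                                 (n C (m + i)) * ((m + i) C m) ≡ (n C m) * ((n ∸ m) C i)
  nC[m+i]*[m+i]Cm≡nCm*[n∸m]Ci n m i m+i≤n =
    *-cancelʳ-≡ _ _ (m ! * i ! * r !) {{m*n≢0 _ _ {{m !* i !≢0}} {{r !≢0}}}} (trans lhs≡n! (sym rhs≡n!))
    where
    r = n ∸ (m + i)
    m≤n : m ≤ n
    m≤n = ≤-trans (m≤m+n m i) m+i≤n
    i≤n∸m : i ≤ n ∸ m
    i≤n∸m = subst (_≤ n ∸ m) (m+n∸m≡n m i) (∸-monoˡ-≤ m m+i≤n)
    inner : ((m + i) C m) * (m ! * i !) ≡ (m + i) !
    inner = subst (λ z → ((m + i) C m) * (m ! * z !) ≡ (m + i) !) (m+n∸m≡n m i) (nCk*k!*[n∸k]!≡n! (m≤m+n m i))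
    outer : ((n ∸ m) C i) * (i ! * r !) ≡ (n ∸ m) !
    outer = subst (λ z → ((n ∸ m) C i) * (i ! * z !) ≡ (n ∸ m) !) (∸-+-assoc n m i) (nCk*k!*[n∸k]!≡n! i≤n∸m)
    lhs≡n! : (n C (m + i)) * ((m + i) C m) * (m ! * i ! * r !) ≡ n !
    lhs≡n! = begin
        (n C (m + i)) * ((m + i) C m) * (m ! * i ! * r !)
      ≡⟨ regroup (n C (m + i)) ((m + i) C m) (m !) (i !) (r !) ⟩
        (n C (m + i)) * (((m + i) C m) * (m ! * i !) * r !)
      ≡⟨ cong (λ z → (n C (m + i)) * (z * r !)) inner ⟩
        (n C (m + i)) * ((m + i) ! * r !)
      ≡⟨ nCk*k!*[n∸k]!≡n! m+i≤n ⟩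
        n ! ∎
      where
      regroup : ∀ a b x y z → a * b * (x * y * z) ≡ a * (b * (x * y) * z)
      regroup = solve-∀
    rhs≡n! : (n C m) * ((n ∸ m) C i) * (m ! * i ! * r !) ≡ n !
    rhs≡n! = begin
        (n C m) * ((n ∸ m) C i) * (m ! * i ! * r !)
      ≡⟨ regroup (n C m) ((n ∸ m) C i) (m !) (i !) (r !) ⟩
        (n C m) * (m ! * (((n ∸ m) C i) * (i ! * r !)))
      ≡⟨ cong (λ z → (n C m) * (m ! * z)) outer ⟩
        (n C m) * (m ! * (n ∸ m) !)
      ≡⟨ nCk*k!*[n∸k]!≡n! m≤n ⟩
        n ! ∎
      where
      regroup : ∀ a b x y z → a * b * (x * y * z) ≡ a * (x * (b * (y * z)))
      regroup = solve-∀

module UmbralAlgebra {c ℓ} (R : CommutativeRing c ℓ) where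
  open CommutativeRing R renaming (Carrier to A) hiding (zero)
  open Umbral R
  open import Data.Nat as ℕ using (zero; suc; _∸_; z≤n; s≤s)
  import Data.Nat.Properties as ℕₚ
  open import Data.Nat.Combinatorics using (_C_; nCk≡nC[n∸k]; nCn≡1; nC1≡n; k>n⇒nCk≡0; nCk+nC[k+1]≡[n+1]C[k+1])
  import Relation.Binary.PropositionalEquality as ≡
  open ≡ using (_≡_; _≢_)
  open import Data.Sum using (inj₁; inj₂)
  open import Data.Empty using (⊥-elim)
  open import Function using (_∘_)
  open import Relation.Nullary using (Dec; yes; no)
  open import Relation.Binary.Reasoning.Setoid setoid
  open import Algebra.Properties.CommutativeSemigroup +-commutativeSemigroup using (interchange)
  open import Algebra.Properties.Ring ring using (-1*x≈-x)

  ∑ : ℕ → (ℕ → A) → A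
  ∑ = sumWith _+_

  syntax ∑ n (λ i → e) = ∑[ i ≤ n ] e

  ∑-cong-≤ : ∀ n {f g} → (∀ i → i ℕ.≤ n → f i ≈ g i) → ∑ n f ≈ ∑ n g
  ∑-cong-≤ zero f≈g = f≈g 0 z≤n
  ∑-cong-≤ (suc n) f≈g = +-cong (∑-cong-≤ n (λ i i≤n → f≈g i (ℕₚ.m≤n⇒m≤1+n i≤n))) (f≈g (suc n) ℕₚ.≤-refl)

  ∑-cong : ∀ n {f g} → (∀ i → f i ≈ g i) → ∑ n f ≈ ∑ n g
  ∑-cong n f≈g = ∑-cong-≤ n (λ i _ → f≈g i)

  ∑-zero : ∀ n {f} → (∀ i → i ℕ.≤ n → f i ≈ 0#) → ∑ n f ≈ 0#
  ∑-zero zero f≈0 = f≈0 0 z≤n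
  ∑-zero (suc n) f≈0 =
    trans (+-cong (∑-zero n (λ i i≤n → f≈0 i (ℕₚ.m≤n⇒m≤1+n i≤n))) (f≈0 (suc n) ℕₚ.≤-refl)) (+-identityʳ 0#)

  ∑-distrib-+ : ∀ n f g → ∑[ i ≤ n ] (f i + g i) ≈ ∑ n f + ∑ n g
  ∑-distrib-+ zero f g = refl
  ∑-distrib-+ (suc n) f g = trans (+-cong (∑-distrib-+ n f g) refl) (interchange _ _ _ _)

  *-distribˡ-∑ : ∀ n x f → x * ∑ n f ≈ ∑[ i ≤ n ] (x * f i)
  *-distribˡ-∑ zero x f = refl
  *-distribˡ-∑ (suc n) x f = trans (distribˡ x _ _) (+-cong (*-distribˡ-∑ n x f) refl)

  *-distribʳ-∑ : ∀ n x f → ∑ n f * x ≈ ∑[ i ≤ n ] (f i * x)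
  *-distribʳ-∑ zero x f = refl
  *-distribʳ-∑ (suc n) x f = trans (distribʳ x _ _) (+-cong (*-distribʳ-∑ n x f) refl)

  ∑-suc : ∀ n f → ∑ (suc n) f ≈ f 0 + ∑[ i ≤ n ] f (suc i)
  ∑-suc zero f = refl
  ∑-suc (suc n) f = trans (+-cong (∑-suc n f) refl) (+-assoc _ _ _)

  ∑-comm : ∀ n m (f : ℕ → ℕ → A) → ∑[ i ≤ n ] ∑[ j ≤ m ] f i j ≈ ∑[ j ≤ m ] ∑[ i ≤ n ] f i j
  ∑-comm zero m f = refl
  ∑-comm (suc n) m f = trans (+-cong (∑-comm n m f) refl) (sym (∑-distrib-+ m _ _))

  ∑-single : ∀ n j {f} → j ℕ.≤ n → (∀ i → i ℕ.≤ n → i ≢ j → f i ≈ 0#) → ∑ n f ≈ f j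
  ∑-single zero .zero z≤n _ = refl
  ∑-single (suc n) j {f} j≤1+n others≈0 with j ℕ.≟ suc n
  ... | yes ≡.refl =
    trans (+-cong (∑-zero n (λ i i≤n → others≈0 i (ℕₚ.m≤n⇒m≤1+n i≤n) (λ { ≡.refl → ℕₚ.1+n≰n i≤n }))) refl)
          (+-identityˡ _)
  ... | no j≢1+n =
    trans (+-cong (∑-single n j (ℕₚ.≤-pred (ℕₚ.≤∧≢⇒< j≤1+n j≢1+n)) (λ i i≤n → others≈0 i (ℕₚ.m≤n⇒m≤1+n i≤n)))
                  (others≈0 (suc n) ℕₚ.≤-refl (j≢1+n ∘ ≡.sym)))
          (+-identityʳ _)

  ∑-head : ∀ n {f} → (∀ i → f (suc i) ≈ 0#) → ∑ n f ≈ f 0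
  ∑-head n tail≈0 = ∑-single n 0 z≤n (λ { zero _ 0≢0 → ⊥-elim (0≢0 ≡.refl) ; (suc i) _ _ → tail≈0 i })

  ∑-truncate : ∀ {n m} f → n ℕ.≤ m → (∀ i → n ℕ.< i → i ℕ.≤ m → f i ≈ 0#) → ∑ m f ≈ ∑ n f
  ∑-truncate {m = zero} f z≤n _ = refl
  ∑-truncate {n} {suc m} f n≤1+m tail≈0 with ℕₚ.m≤n⇒m<n∨m≡n n≤1+m
  ... | inj₂ ≡.refl = refl
  ... | inj₁ n<1+m =
    trans (+-cong (∑-truncate f (ℕₚ.≤-pred n<1+m) (λ i n<i i≤m → tail≈0 i n<i (ℕₚ.m≤n⇒m≤1+n i≤m)))
                  (tail≈0 (suc m) n<1+m ℕₚ.≤-refl))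
          (+-identityʳ _)

  ∑-skip : ∀ m r {f} → (∀ k → k ℕ.< m → f k ≈ 0#) → ∑ (m ℕ.+ r) f ≈ ∑[ i ≤ r ] f (m ℕ.+ i)
  ∑-skip m zero {f} head≈0 = ∑-single (m ℕ.+ 0) (m ℕ.+ 0) ℕₚ.≤-refl
    (λ i i≤m+0 i≢ → head≈0 i (≡.subst (i ℕ.<_) (ℕₚ.+-identityʳ m) (ℕₚ.≤∧≢⇒< i≤m+0 i≢)))
  ∑-skip m (suc r) {f} head≈0 = begin
      ∑ (m ℕ.+ suc r) f
    ≡⟨ ≡.cong (λ k → ∑ k f) (ℕₚ.+-suc m r) ⟩
      ∑ (m ℕ.+ r) f + f (suc (m ℕ.+ r))
    ≈⟨ +-cong (∑-skip m r head≈0) (reflexive (≡.cong f (≡.sym (ℕₚ.+-suc m r)))) ⟩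
      ∑[ i ≤ suc r ] f (m ℕ.+ i) ∎

  natR-+ : ∀ m n → natR (m ℕ.+ n) ≈ natR m + natR n
  natR-+ zero n = sym (+-identityˡ _)
  natR-+ (suc m) n = trans (+-cong refl (natR-+ m n)) (sym (+-assoc _ _ _))

  natR-* : ∀ m n → natR (m ℕ.* n) ≈ natR m * natR n
  natR-* zero n = sym (zeroˡ _)
  natR-* (suc m) n =
    trans (natR-+ n (m ℕ.* n)) (trans (+-cong (sym (*-identityˡ _)) (natR-* m n)) (sym (distribʳ _ _ _)))

  natR-cong : ∀ {m n} → m ≡ n → natR m ≈ natR n
  natR-cong ≡.refl = refl

  choose-n-0 : ∀ n → choose n 0 ≈ 1#
  choose-n-0 n = +-identityʳ 1#

  choose-n-n : ∀ n → choose n n ≈ 1#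
  choose-n-n n = trans (natR-cong (nCn≡1 n)) (+-identityʳ 1#)

  choose-vanish-* : ∀ {n k} x → n ℕ.< k → choose n k * x ≈ 0#
  choose-vanish-* x n<k = trans (*-cong (natR-cong (k>n⇒nCk≡0 n<k)) refl) (zeroˡ x)

  choose-pascal : ∀ n k → choose (suc n) (suc k) ≈ choose n k + choose n (suc k)
  choose-pascal n k = trans (natR-cong (≡.sym (nCk+nC[k+1]≡[n+1]C[k+1] n k))) (natR-+ (n C k) (n C suc k))

  Series : Set c
  Series = ℕ → A

  _≈ˢ_ : Series → Series → Set ℓ
  F ≈ˢ G = ∀ i → F i ≈ G i

  δ : Series
  δ zero = 1#
  δ (suc n) = 0#

  ∂ : Series → Series
  ∂ F n = F (suc n)

  infixl 7 _⋆_
  _⋆_ : Series → Series → Series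
  (F ⋆ G) n = ∑[ k ≤ n ] (choose n k * (F k * G (n ∸ k)))

  δ-≢0 : ∀ {m} → m ≢ 0 → δ m ≈ 0#
  δ-≢0 {zero} m≢0 = ⊥-elim (m≢0 ≡.refl)
  δ-≢0 {suc m} _ = refl

  ∂-ext : ∀ {F G} → F 0 ≈ G 0 → ∂ F ≈ˢ ∂ G → F ≈ˢ G
  ∂-ext F0≈G0 _ zero = F0≈G0
  ∂-ext _ ∂F≈∂G (suc i) = ∂F≈∂G i

  ⋆-cong-≤ : ∀ n {F F′ G G′} → (∀ i → i ℕ.≤ n → F i ≈ F′ i) → (∀ i → i ℕ.≤ n → G i ≈ G′ i) →
             (F ⋆ G) n ≈ (F′ ⋆ G′) n
  ⋆-cong-≤ n F≈F′ G≈G′ = ∑-cong-≤ n (λ k k≤n → *-cong refl (*-cong (F≈F′ k k≤n) (G≈G′ (n ∸ k) (ℕₚ.m∸n≤m n k))))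

  ⋆-congˡ : ∀ n {F F′} G → F ≈ˢ F′ → (F ⋆ G) n ≈ (F′ ⋆ G) n
  ⋆-congˡ n G F≈F′ = ⋆-cong-≤ n {G = G} {G′ = G} (λ i _ → F≈F′ i) (λ _ _ → refl)

  ⋆-congʳ : ∀ n F {G G′} → G ≈ˢ G′ → (F ⋆ G) n ≈ (F ⋆ G′) n
  ⋆-congʳ n F G≈G′ = ⋆-cong-≤ n {F = F} {F′ = F} (λ _ _ → refl) (λ i _ → G≈G′ i)

  ⋆-at-0 : ∀ F G → (F ⋆ G) 0 ≈ F 0 * G 0
  ⋆-at-0 F G = trans (*-cong (choose-n-0 0) refl) (*-identityˡ _)

  ⋆-∂ʳ-expand : ∀ n F G → choose n 0 * (F 0 * G (suc n)) + ∑[ k ≤ n ] (choose n (suc k) * (F (suc k) * G (n ∸ k)))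
                          ≈ (F ⋆ ∂ G) n
  ⋆-∂ʳ-expand zero F G =
    trans (+-cong refl (choose-vanish-* {0} {1} _ (s≤s z≤n))) (+-identityʳ _)
  ⋆-∂ʳ-expand (suc m) F G = begin
      choose (suc m) 0 * (F 0 * G (suc (suc m))) + ∑[ k ≤ suc m ] (choose (suc m) (suc k) * (F (suc k) * G (suc m ∸ k)))
    ≈⟨ +-cong refl (trans (+-cong refl (choose-vanish-* {suc m} {suc (suc m)} _ ℕₚ.≤-refl)) (+-identityʳ _)) ⟩
      choose (suc m) 0 * (F 0 * G (suc (suc m))) + ∑[ k ≤ m ] (choose (suc m) (suc k) * (F (suc k) * G (suc m ∸ k)))
    ≈⟨ +-cong refl (∑-cong-≤ m (λ k k≤m → *-cong refl (*-cong refl (reflexive (≡.cong G (ℕₚ.+-∸-assoc 1 k≤m)))))) ⟩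
      choose (suc m) 0 * (F 0 * G (suc (suc m))) + ∑[ k ≤ m ] (choose (suc m) (suc k) * (F (suc k) * G (suc (m ∸ k))))
    ≈⟨ ∑-suc m _ ⟨
      (F ⋆ ∂ G) (suc m) ∎

  -- Leibniz rule (F G)′ = F′ G + F G′, as ∂ is differentiation of exponential generating functions.
  ⋆-∂ : ∀ F G n → (F ⋆ G) (suc n) ≈ (∂ F ⋆ G) n + (F ⋆ ∂ G) n
  ⋆-∂ F G n = begin
      (F ⋆ G) (suc n)
    ≈⟨ ∑-suc n _ ⟩
      choose (suc n) 0 * (F 0 * G (suc n)) + ∑[ k ≤ n ] (choose (suc n) (suc k) * (F (suc k) * G (n ∸ k)))
    ≈⟨ +-cong refl (∑-cong n (λ k → trans (*-cong (choose-pascal n k) refl) (distribʳ _ _ _))) ⟩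
      choose (suc n) 0 * (F 0 * G (suc n))
        + ∑[ k ≤ n ] (choose n k * (F (suc k) * G (n ∸ k)) + choose n (suc k) * (F (suc k) * G (n ∸ k)))
    ≈⟨ +-cong refl (∑-distrib-+ n _ _) ⟩
      choose (suc n) 0 * (F 0 * G (suc n))
        + ((∂ F ⋆ G) n + ∑[ k ≤ n ] (choose n (suc k) * (F (suc k) * G (n ∸ k))))
    ≈⟨ trans (sym (+-assoc _ _ _)) (trans (+-cong (+-comm _ _) refl) (+-assoc _ _ _)) ⟩
      (∂ F ⋆ G) n + (choose n 0 * (F 0 * G (suc n)) + ∑[ k ≤ n ] (choose n (suc k) * (F (suc k) * G (n ∸ k))))
    ≈⟨ +-cong refl (⋆-∂ʳ-expand n F G) ⟩
      (∂ F ⋆ G) n + (F ⋆ ∂ G) n ∎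

  ⋆-comm : ∀ n F G → (F ⋆ G) n ≈ (G ⋆ F) n
  ⋆-comm zero F G = *-cong refl (*-comm _ _)
  ⋆-comm (suc n) F G =
    trans (⋆-∂ F G n) (trans (+-cong (⋆-comm n (∂ F) G) (⋆-comm n F (∂ G))) (trans (+-comm _ _) (sym (⋆-∂ G F n))))

  ⋆-distribʳ-+ : ∀ n F G H → ((λ i → F i + G i) ⋆ H) n ≈ (F ⋆ H) n + (G ⋆ H) n
  ⋆-distribʳ-+ n F G H = trans (∑-cong n (λ k → trans (*-cong refl (distribʳ _ _ _)) (distribˡ _ _ _))) (∑-distrib-+ n _ _)

  ⋆-distribˡ-+ : ∀ n F G H → (H ⋆ (λ i → F i + G i)) n ≈ (H ⋆ F) n + (H ⋆ G) n
  ⋆-distribˡ-+ n F G H = trans (∑-cong n (λ k → trans (*-cong refl (distribˡ _ _ _)) (distribˡ _ _ _))) (∑-distrib-+ n _ _)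

  x∙yz≈y∙xz : ∀ x y z → x * (y * z) ≈ y * (x * z)
  x∙yz≈y∙xz x y z = trans (sym (*-assoc x y z)) (trans (*-cong (*-comm x y) refl) (*-assoc y x z))

  ⋆-scalarˡ : ∀ n x F G → ((λ i → x * F i) ⋆ G) n ≈ x * (F ⋆ G) n
  ⋆-scalarˡ n x F G = trans (∑-cong n (λ k → trans (*-cong refl (*-assoc _ _ _)) (x∙yz≈y∙xz _ _ _))) (sym (*-distribˡ-∑ n x _))

  ⋆-assoc : ∀ n F G H → ((F ⋆ G) ⋆ H) n ≈ (F ⋆ (G ⋆ H)) n
  ⋆-assoc zero F G H =
    trans (⋆-at-0 (F ⋆ G) H) (trans (*-cong (⋆-at-0 F G) refl) (trans (*-assoc _ _ _)
      (sym (trans (⋆-at-0 F (G ⋆ H)) (*-cong refl (⋆-at-0 G H))))))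
  ⋆-assoc (suc n) F G H = begin
      ((F ⋆ G) ⋆ H) (suc n)
    ≈⟨ ⋆-∂ (F ⋆ G) H n ⟩
      (∂ (F ⋆ G) ⋆ H) n + ((F ⋆ G) ⋆ ∂ H) n
    ≈⟨ +-cong (⋆-congˡ n H (⋆-∂ F G)) refl ⟩
      ((λ i → (∂ F ⋆ G) i + (F ⋆ ∂ G) i) ⋆ H) n + ((F ⋆ G) ⋆ ∂ H) n
    ≈⟨ +-cong (⋆-distribʳ-+ n (∂ F ⋆ G) (F ⋆ ∂ G) H) refl ⟩
      (((∂ F ⋆ G) ⋆ H) n + ((F ⋆ ∂ G) ⋆ H) n) + ((F ⋆ G) ⋆ ∂ H) n
    ≈⟨ +-cong (+-cong (⋆-assoc n (∂ F) G H) (⋆-assoc n F (∂ G) H)) (⋆-assoc n F G (∂ H)) ⟩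
      ((∂ F ⋆ (G ⋆ H)) n + (F ⋆ (∂ G ⋆ H)) n) + (F ⋆ (G ⋆ ∂ H)) n
    ≈⟨ +-assoc _ _ _ ⟩
      (∂ F ⋆ (G ⋆ H)) n + ((F ⋆ (∂ G ⋆ H)) n + (F ⋆ (G ⋆ ∂ H)) n)
    ≈⟨ +-cong refl (⋆-distribˡ-+ n (∂ G ⋆ H) (G ⋆ ∂ H) F) ⟨
      (∂ F ⋆ (G ⋆ H)) n + (F ⋆ (λ i → (∂ G ⋆ H) i + (G ⋆ ∂ H) i)) n
    ≈⟨ +-cong refl (⋆-congʳ n F (λ i → ⋆-∂ G H i)) ⟨
      (∂ F ⋆ (G ⋆ H)) n + (F ⋆ ∂ (G ⋆ H)) n
    ≈⟨ ⋆-∂ F (G ⋆ H) n ⟨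
      (F ⋆ (G ⋆ H)) (suc n) ∎

  ⋆-identityˡ : ∀ n F → (δ ⋆ F) n ≈ F n
  ⋆-identityˡ n F =
    trans (∑-head n (λ _ → trans (*-cong refl (zeroˡ _)) (zeroʳ _)))
          (trans (*-cong (choose-n-0 n) (*-identityˡ _)) (*-identityˡ _))

  ⋆-identityʳ : ∀ n F → (F ⋆ δ) n ≈ F n
  ⋆-identityʳ n F = trans (⋆-comm n F δ) (⋆-identityˡ n F)

  Bell : Series → ℕ → ℕ → A
  Bell G zero zero = 1#
  Bell G zero (suc n) = 0#
  Bell G (suc k) zero = 0#
  Bell G (suc k) (suc n) = ∑[ j ≤ n ] (choose n j * (G (suc j) * Bell G k (n ∸ j)))

  infixr 9 _∘ˢ_
  _∘ˢ_ : Series → Series → Series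
  (F ∘ˢ G) n = ∑[ k ≤ n ] (F k * Bell G k n)

  Bell-0 : ∀ G n → Bell G 0 n ≈ δ n
  Bell-0 G zero = refl
  Bell-0 G (suc n) = refl

  Bell-vanish : ∀ G k n → n ℕ.< k → Bell G k n ≈ 0#
  Bell-vanish G (suc k) zero _ = refl
  Bell-vanish G (suc k) (suc n) (s≤s n<k) =
    ∑-zero n (λ j j≤n → trans (*-cong refl (trans (*-cong refl
      (Bell-vanish G k (n ∸ j) (ℕₚ.≤-<-trans (ℕₚ.m∸n≤m n j) n<k))) (zeroʳ _))) (zeroʳ _))

  ∘ˢ-at-0 : ∀ F G → (F ∘ˢ G) 0 ≈ F 0
  ∘ˢ-at-0 F G = *-identityʳ _

  ∘ˢ-congˡ-≤ : ∀ n {F F′} G → (∀ i → i ℕ.≤ n → F i ≈ F′ i) → (F ∘ˢ G) n ≈ (F′ ∘ˢ G) n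
  ∘ˢ-congˡ-≤ n G F≈F′ = ∑-cong-≤ n (λ k k≤n → *-cong (F≈F′ k k≤n) refl)

  ∘ˢ-distribʳ-+ : ∀ n F F′ G → ((λ i → F i + F′ i) ∘ˢ G) n ≈ (F ∘ˢ G) n + (F′ ∘ˢ G) n
  ∘ˢ-distribʳ-+ n F F′ G = trans (∑-cong n (λ k → distribʳ _ _ _)) (∑-distrib-+ n _ _)

  ∂-∘ˢ : ∀ F G n → (F ∘ˢ G) (suc n) ≈ (∂ G ⋆ (∂ F ∘ˢ G)) n
  ∂-∘ˢ F G n = begin
      (F ∘ˢ G) (suc n)
    ≈⟨ ∑-suc n _ ⟩
      F 0 * 0# + ∑[ k ≤ n ] (F (suc k) * Bell G (suc k) (suc n))
    ≈⟨ trans (+-cong (zeroʳ _) refl) (+-identityˡ _) ⟩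
      ∑[ k ≤ n ] (F (suc k) * ∑[ j ≤ n ] (choose n j * (G (suc j) * Bell G k (n ∸ j))))
    ≈⟨ ∑-cong n (λ k → trans (*-distribˡ-∑ n _ _) (∑-cong n (λ j → trans (x∙yz≈y∙xz _ _ _) (*-cong refl (x∙yz≈y∙xz _ _ _))))) ⟩
      ∑[ k ≤ n ] ∑[ j ≤ n ] (choose n j * (G (suc j) * (F (suc k) * Bell G k (n ∸ j))))
    ≈⟨ ∑-comm n n _ ⟩
      ∑[ j ≤ n ] ∑[ k ≤ n ] (choose n j * (G (suc j) * (F (suc k) * Bell G k (n ∸ j))))
    ≈⟨ ∑-cong n (λ j → trans (*-cong refl (*-distribˡ-∑ n _ _)) (*-distribˡ-∑ n _ _)) ⟨
      ∑[ j ≤ n ] (choose n j * (G (suc j) * ∑[ k ≤ n ] (F (suc k) * Bell G k (n ∸ j))))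
    ≈⟨ ∑-cong n (λ j → *-cong refl (*-cong refl (∑-truncate _ (ℕₚ.m∸n≤m n j)
          (λ i n∸j<i _ → trans (*-cong refl (Bell-vanish G i (n ∸ j) n∸j<i)) (zeroʳ _))))) ⟩
      (∂ G ⋆ (∂ F ∘ˢ G)) n ∎

  -- The bound m ≤ n makes the induction hypothesis available at every lower degree.
  ∘ˢ-distrib-⋆ : ∀ G n m → m ℕ.≤ n → ∀ P Q → ((P ⋆ Q) ∘ˢ G) m ≈ ((P ∘ˢ G) ⋆ (Q ∘ˢ G)) m
  ∘ˢ-distrib-⋆ G zero .zero z≤n P Q =
    trans (∘ˢ-at-0 (P ⋆ Q) G) (trans (⋆-at-0 P Q)
      (sym (trans (⋆-at-0 (P ∘ˢ G) (Q ∘ˢ G)) (*-cong (∘ˢ-at-0 P G) (∘ˢ-at-0 Q G)))))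
  ∘ˢ-distrib-⋆ G (suc n) m m≤1+n P Q with ℕₚ.m≤n⇒m<n∨m≡n m≤1+n
  ... | inj₁ m<1+n = ∘ˢ-distrib-⋆ G n m (ℕₚ.≤-pred m<1+n) P Q
  ... | inj₂ ≡.refl = begin
      ((P ⋆ Q) ∘ˢ G) (suc n)
    ≈⟨ ∂-∘ˢ (P ⋆ Q) G n ⟩
      (∂ G ⋆ (∂ (P ⋆ Q) ∘ˢ G)) n
    ≈⟨ ⋆-cong-≤ n {F = ∂ G} {F′ = ∂ G} (λ _ _ → refl)
         (λ i _ → trans (∘ˢ-congˡ-≤ i G (λ j _ → ⋆-∂ P Q j)) (∘ˢ-distribʳ-+ i (∂ P ⋆ Q) (P ⋆ ∂ Q) G)) ⟩
      (∂ G ⋆ (λ i → ((∂ P ⋆ Q) ∘ˢ G) i + ((P ⋆ ∂ Q) ∘ˢ G) i)) n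
    ≈⟨ ⋆-cong-≤ n {F = ∂ G} {F′ = ∂ G} (λ _ _ → refl)
         (λ i i≤n → +-cong (∘ˢ-distrib-⋆ G n i i≤n (∂ P) Q) (∘ˢ-distrib-⋆ G n i i≤n P (∂ Q))) ⟩
      (∂ G ⋆ (λ i → (∂P∘G ⋆ Q∘G) i + (P∘G ⋆ ∂Q∘G) i)) n
    ≈⟨ ⋆-distribˡ-+ n (∂P∘G ⋆ Q∘G) (P∘G ⋆ ∂Q∘G) (∂ G) ⟩
      (∂ G ⋆ (∂P∘G ⋆ Q∘G)) n + (∂ G ⋆ (P∘G ⋆ ∂Q∘G)) n
    ≈⟨ +-cong (sym (⋆-assoc n (∂ G) ∂P∘G Q∘G)) (trans (sym (⋆-assoc n (∂ G) P∘G ∂Q∘G))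
         (trans (⋆-congˡ n ∂Q∘G (λ i → ⋆-comm i (∂ G) P∘G)) (⋆-assoc n P∘G (∂ G) ∂Q∘G))) ⟩
      ((∂ G ⋆ ∂P∘G) ⋆ Q∘G) n + (P∘G ⋆ (∂ G ⋆ ∂Q∘G)) n
    ≈⟨ +-cong (⋆-congˡ n Q∘G (λ i → ∂-∘ˢ P G i)) (⋆-congʳ n P∘G (λ i → ∂-∘ˢ Q G i)) ⟨
      (∂ P∘G ⋆ Q∘G) n + (P∘G ⋆ ∂ Q∘G) n
    ≈⟨ ⋆-∂ P∘G Q∘G n ⟨
      (P∘G ⋆ Q∘G) (suc n) ∎
    where
    P∘G = P ∘ˢ G
    Q∘G = Q ∘ˢ G
    ∂P∘G = ∂ P ∘ˢ G
    ∂Q∘G = ∂ Q ∘ˢ G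

  eᵗ : Series
  eᵗ _ = 1#

  tˢ : Series
  tˢ zero = 0#
  tˢ (suc zero) = 1#
  tˢ (suc (suc n)) = 0#

  1+t : Series
  1+t zero = 1#
  1+t (suc zero) = 1#
  1+t (suc (suc n)) = 0#

  noConst : Series → Series
  noConst F zero = 0#
  noConst F (suc n) = F (suc n)

  logˢ : Series → Series
  logˢ F = logCoeff ∘ˢ noConst F

  -- exp(-log F) = 1/F, the moments of -1.α
  recipˢ : Series → Series
  recipˢ F = eᵗ ∘ˢ (λ n → - 1# * logˢ F n)

  -- ∂ logCoeff is the coefficient sequence of 1/(1+t).
  1+t-⋆-∂logCoeff : ∀ n → (1+t ⋆ ∂ logCoeff) n ≈ δ n
  1+t-⋆-∂logCoeff zero = trans (⋆-at-0 1+t (∂ logCoeff)) (*-identityˡ _)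
  1+t-⋆-∂logCoeff (suc m) = begin
      (1+t ⋆ ∂ logCoeff) (suc m)
    ≈⟨ ∑-suc m _ ⟩
      choose (suc m) 0 * (1# * logCoeff (suc (suc m)))
        + ∑[ k ≤ m ] (choose (suc m) (suc k) * (1+t (suc k) * logCoeff (suc (m ∸ k))))
    ≈⟨ +-cong (trans (*-cong (choose-n-0 (suc m)) (*-identityˡ _)) (*-identityˡ _))
              (∑-head m (λ _ → trans (*-cong refl (zeroˡ _)) (zeroʳ _))) ⟩
      logCoeff (suc (suc m)) + choose (suc m) 1 * (1# * logCoeff (suc m))
    ≈⟨ +-cong refl (*-cong (natR-cong (nC1≡n (suc m))) (*-identityˡ _)) ⟩
      - (natR (suc m) * logCoeff (suc m)) + natR (suc m) * logCoeff (suc m)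
    ≈⟨ -‿inverseˡ _ ⟩
      0# ∎

  δ-∘ˢ : ∀ G n → (δ ∘ˢ G) n ≈ δ n
  δ-∘ˢ G n = trans (∑-head n (λ _ → zeroˡ _))
                   (trans (*-identityˡ _) (Bell-0 G n))

  1+t-∘ˢ-noConst : ∀ F → F 0 ≈ 1# → (1+t ∘ˢ noConst F) ≈ˢ F
  1+t-∘ˢ-noConst F F0≈1 zero = trans (∘ˢ-at-0 1+t (noConst F)) (sym F0≈1)
  1+t-∘ˢ-noConst F F0≈1 (suc n) = begin
      (1+t ∘ˢ G) (suc n)
    ≈⟨ ∑-suc n _ ⟩
      1# * 0# + ∑[ k ≤ n ] (1+t (suc k) * Bell G (suc k) (suc n))
    ≈⟨ trans (+-cong (zeroʳ _) refl) (+-identityˡ _) ⟩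
      ∑[ k ≤ n ] (1+t (suc k) * Bell G (suc k) (suc n))
    ≈⟨ ∑-head n (λ _ → zeroˡ _) ⟩
      1# * ∑[ j ≤ n ] (choose n j * (G (suc j) * Bell G 0 (n ∸ j)))
    ≈⟨ *-identityˡ _ ⟩
      ∑[ j ≤ n ] (choose n j * (G (suc j) * Bell G 0 (n ∸ j)))
    ≈⟨ ∑-single n n ℕₚ.≤-refl (λ j j≤n j≢n → trans (*-cong refl (trans (*-cong refl
          (trans (Bell-0 G (n ∸ j)) (δ-≢0 (λ n∸j≡0 → j≢n (ℕₚ.≤-antisym j≤n (ℕₚ.m∸n≡0⇒m≤n n∸j≡0)))))) (zeroʳ _))) (zeroʳ _)) ⟩
      choose n n * (F (suc n) * Bell G 0 (n ∸ n))
    ≈⟨ *-cong (choose-n-n n) (*-cong refl (trans (Bell-0 G (n ∸ n)) (reflexive (≡.cong δ (ℕₚ.n∸n≡0 n))))) ⟩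
      1# * (F (suc n) * 1#)
    ≈⟨ trans (*-identityˡ _) (*-identityʳ _) ⟩
      F (suc n) ∎
    where G = noConst F

  -- Writing F = (1+t) ∘ (F - 1), its inverse is 1/(1+t) composed with F - 1.
  ∂logCoeff∘noConst-inverseˡ : ∀ F → F 0 ≈ 1# → ∀ n → ((∂ logCoeff ∘ˢ noConst F) ⋆ F) n ≈ δ n
  ∂logCoeff∘noConst-inverseˡ F F0≈1 n = begin
      ((∂ logCoeff ∘ˢ G) ⋆ F) n
    ≈⟨ ⋆-congʳ n (∂ logCoeff ∘ˢ G) (1+t-∘ˢ-noConst F F0≈1) ⟨
      ((∂ logCoeff ∘ˢ G) ⋆ (1+t ∘ˢ G)) n
    ≈⟨ ∘ˢ-distrib-⋆ G n n ℕₚ.≤-refl (∂ logCoeff) 1+t ⟨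
      ((∂ logCoeff ⋆ 1+t) ∘ˢ G) n
    ≈⟨ ∘ˢ-congˡ-≤ n G (λ i _ → trans (⋆-comm i (∂ logCoeff) 1+t) (1+t-⋆-∂logCoeff i)) ⟩
      (δ ∘ˢ G) n
    ≈⟨ δ-∘ˢ G n ⟩
      δ n ∎
    where G = noConst F

  logˢ-eᵗ : logˢ eᵗ ≈ˢ tˢ
  logˢ-eᵗ = ∂-ext (∘ˢ-at-0 logCoeff (noConst eᵗ)) (λ n → begin
      logˢ eᵗ (suc n)
    ≈⟨ ∂-∘ˢ logCoeff (noConst eᵗ) n ⟩
      (eᵗ ⋆ (∂ logCoeff ∘ˢ noConst eᵗ)) n
    ≈⟨ ⋆-comm n eᵗ (∂ logCoeff ∘ˢ noConst eᵗ) ⟩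
      ((∂ logCoeff ∘ˢ noConst eᵗ) ⋆ eᵗ) n
    ≈⟨ ∂logCoeff∘noConst-inverseˡ eᵗ refl n ⟩
      δ n
    ≈⟨ δ≈∂tˢ n ⟩
      tˢ (suc n) ∎)
    where
    δ≈∂tˢ : ∀ n → δ n ≈ tˢ (suc n)
    δ≈∂tˢ zero = refl
    δ≈∂tˢ (suc n) = refl

  -- (N F)′ = N′ F + N F′ = 0, because N′ = -(F′/F) N and 1/F is ∂ logCoeff composed with F - 1.
  recipˢ-inverseˡ : ∀ F → F 0 ≈ 1# → (recipˢ F ⋆ F) ≈ˢ δ
  recipˢ-inverseˡ F F0≈1 = ∂-ext at-0 at-suc
    where
    N = recipˢ F
    F⁻¹ = ∂ logCoeff ∘ˢ noConst F
    N∂F = N ⋆ ∂ F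
    at-0 : (N ⋆ F) 0 ≈ 1#
    at-0 = trans (⋆-at-0 N F) (trans (*-cong (∘ˢ-at-0 eᵗ (λ n → - 1# * logˢ F n)) F0≈1) (*-identityˡ _))
    ∂N : ∀ i → ∂ N i ≈ - 1# * (((∂ F ⋆ F⁻¹) ⋆ N) i)
    ∂N i = begin
        N (suc i)
      ≈⟨ ∂-∘ˢ eᵗ _ i ⟩
        ((λ j → - 1# * logˢ F (suc j)) ⋆ N) i
      ≈⟨ ⋆-congˡ i N (λ j → *-cong refl (∂-∘ˢ logCoeff (noConst F) j)) ⟩
        ((λ j → - 1# * (∂ F ⋆ F⁻¹) j) ⋆ N) i
      ≈⟨ ⋆-scalarˡ i (- 1#) (∂ F ⋆ F⁻¹) N ⟩
        - 1# * ((∂ F ⋆ F⁻¹) ⋆ N) i ∎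
    cancel-F⁻¹ : ∀ n → (((∂ F ⋆ F⁻¹) ⋆ N) ⋆ F) n ≈ N∂F n
    cancel-F⁻¹ n = begin
        (((∂ F ⋆ F⁻¹) ⋆ N) ⋆ F) n
      ≈⟨ ⋆-congˡ n F (λ i → trans (⋆-comm i (∂ F ⋆ F⁻¹) N) (sym (⋆-assoc i N (∂ F) F⁻¹))) ⟩
        ((N∂F ⋆ F⁻¹) ⋆ F) n
      ≈⟨ ⋆-assoc n N∂F F⁻¹ F ⟩
        (N∂F ⋆ (F⁻¹ ⋆ F)) n
      ≈⟨ ⋆-congʳ n N∂F (∂logCoeff∘noConst-inverseˡ F F0≈1) ⟩
        (N∂F ⋆ δ) n
      ≈⟨ ⋆-identityʳ n N∂F ⟩
        N∂F n ∎
    at-suc : ∀ n → (N ⋆ F) (suc n) ≈ δ (suc n)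
    at-suc n = begin
        (N ⋆ F) (suc n)
      ≈⟨ ⋆-∂ N F n ⟩
        (∂ N ⋆ F) n + N∂F n
      ≈⟨ +-cong (⋆-congˡ n F ∂N) refl ⟩
        ((λ i → - 1# * ((∂ F ⋆ F⁻¹) ⋆ N) i) ⋆ F) n + N∂F n
      ≈⟨ +-cong (trans (⋆-scalarˡ n (- 1#) _ F) (*-cong refl (cancel-F⁻¹ n))) refl ⟩
        - 1# * N∂F n + N∂F n
      ≈⟨ +-cong (-1*x≈-x _) refl ⟩
        - N∂F n + N∂F n
      ≈⟨ -‿inverseˡ _ ⟩
        0# ∎

  sumP-apply : ∀ n (f : ℕ → Poly) k → sumP n f k ≈ ∑[ i ≤ n ] f i k
  sumP-apply zero f k = refl
  sumP-apply (suc n) f k = +-cong (sumP-apply n f k) refl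

  *P-cong : ∀ {p p′ q q′} → p ≈P p′ → q ≈P q′ → (p *P q) ≈P (p′ *P q′)
  *P-cong p≈p′ q≈q′ k = ∑-cong k (λ i → *-cong (p≈p′ i) (q≈q′ (k ∸ i)))

  constP-≢0 : ∀ a {m} → m ≢ 0 → constP a m ≈ 0#
  constP-≢0 a {zero} m≢0 = ⊥-elim (m≢0 ≡.refl)
  constP-≢0 a {suc m} _ = refl

  constP-*P : ∀ a q → (constP a *P q) ≈P (a ·P q)
  constP-*P a q k = ∑-head k (λ _ → zeroˡ _)

  *P-constP : ∀ a p → (p *P constP a) ≈P (a ·P p)
  *P-constP a p k =
    trans (∑-single k k ℕₚ.≤-refl (λ i i≤k i≢k →
             trans (*-cong refl (constP-≢0 a (λ k∸i≡0 → i≢k (ℕₚ.≤-antisym i≤k (ℕₚ.m∸n≡0⇒m≤n k∸i≡0))))) (zeroʳ _)))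
          (trans (*-cong refl (reflexive (≡.cong (constP a) (ℕₚ.n∸n≡0 k)))) (*-comm _ _))

  *-constP : ∀ a b m → a * constP b m ≈ constP (a * b) m
  *-constP a b zero = refl
  *-constP a b (suc m) = zeroʳ _

  constP-*P-constP : ∀ a b → (constP a *P constP b) ≈P constP (a * b)
  constP-*P-constP a b m = trans (constP-*P a (constP b) m) (*-constP a b m)

  ∑-constP : ∀ n (f : ℕ → A) m → ∑[ j ≤ n ] constP (f j) m ≈ constP (∑ n f) m
  ∑-constP n f zero = refl
  ∑-constP n f (suc m) = ∑-zero n (λ _ _ → refl)

  -- μ is a scalar umbra with moments f.
  infix 4 _≈ᶜ_
  _≈ᶜ_ : Seq → Series → Set ℓ
  μ ≈ᶜ f = ∀ n → μ n ≈P constP (f n)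

  lift-≈ᶜ : ∀ f → lift f ≈ᶜ f
  lift-≈ᶜ f n m = refl

  minusOne-≈ᶜ : ∀ {μ f} → μ ≈ᶜ f → minusOne μ ≈ᶜ noConst f
  minusOne-≈ᶜ μ≈f zero m = refl
  minusOne-≈ᶜ μ≈f (suc n) m = μ≈f (suc n) m

  bellB-≈ᶜ : ∀ {μ f} → μ ≈ᶜ f → ∀ k n → bellB μ k n ≈P constP (Bell f k n)
  bellB-≈ᶜ μ≈f zero zero m = refl
  bellB-≈ᶜ μ≈f zero (suc n) m = refl
  bellB-≈ᶜ μ≈f (suc k) zero m = refl
  bellB-≈ᶜ {μ} {f} μ≈f (suc k) (suc n) m = begin
      sumP n (λ j → choose n j ·P (μ (suc j) *P bellB μ k (n ∸ j))) m
    ≈⟨ sumP-apply n _ m ⟩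
      ∑[ j ≤ n ] (choose n j * (μ (suc j) *P bellB μ k (n ∸ j)) m)
    ≈⟨ ∑-cong n (λ j → *-cong refl (trans (*P-cong (μ≈f (suc j)) (bellB-≈ᶜ μ≈f k (n ∸ j)) m) (constP-*P-constP _ _ m))) ⟩
      ∑[ j ≤ n ] (choose n j * constP (f (suc j) * Bell f k (n ∸ j)) m)
    ≈⟨ ∑-cong n (λ j → *-constP _ _ m) ⟩
      ∑[ j ≤ n ] constP (choose n j * (f (suc j) * Bell f k (n ∸ j))) m
    ≈⟨ ∑-constP n _ m ⟩
      constP (Bell f (suc k) (suc n)) m ∎

  compose-≈ᶜ : ∀ {μ f ν g} → μ ≈ᶜ f → ν ≈ᶜ g → compose μ ν ≈ᶜ (f ∘ˢ g)
  compose-≈ᶜ {μ} {f} {ν} {g} μ≈f ν≈g n m = begin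
      sumP n (λ k → μ k *P bellB ν k n) m
    ≈⟨ sumP-apply n _ m ⟩
      ∑[ k ≤ n ] (μ k *P bellB ν k n) m
    ≈⟨ ∑-cong n (λ k → trans (*P-cong (μ≈f k) (bellB-≈ᶜ ν≈g k n) m) (constP-*P-constP _ _ m)) ⟩
      ∑[ k ≤ n ] constP (f k * Bell g k n) m
    ≈⟨ ∑-constP n _ m ⟩
      constP ((f ∘ˢ g) n) m ∎

  logS-≈ᶜ : ∀ {μ f} → μ ≈ᶜ f → logS μ ≈ᶜ logˢ f
  logS-≈ᶜ μ≈f = compose-≈ᶜ (lift-≈ᶜ logCoeff) (minusOne-≈ᶜ μ≈f)

  negU-≈ᶜ : ∀ f → negU (lift f) ≈ᶜ recipˢ f
  negU-≈ᶜ f = compose-≈ᶜ (lift-≈ᶜ eᵗ)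
    (λ n m → trans (*P-cong (λ _ → refl) (logS-≈ᶜ (lift-≈ᶜ f) n) m) (constP-*P-constP _ _ m))

  gammaInvˢ : Series → Series
  gammaInvˢ h zero = 1#
  gammaInvˢ h (suc n) = h (suc n)

  gammaInv-≈ᶜ : ∀ h → gammaInv h ≈ᶜ gammaInvˢ h
  gammaInv-≈ᶜ h zero m = refl
  gammaInv-≈ᶜ h (suc n) m = refl

  gammaStar-≈ᶜ : ∀ h → gammaStar h ≈ᶜ (eᵗ ∘ˢ noConst eᵗ) ∘ˢ logˢ (gammaInvˢ h)
  gammaStar-≈ᶜ h = compose-≈ᶜ (compose-≈ᶜ (lift-≈ᶜ eᵗ) (minusOne-≈ᶜ (lift-≈ᶜ eᵗ))) (logS-≈ᶜ (gammaInv-≈ᶜ h))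

  Bell-cong : ∀ {f g} → f ≈ˢ g → ∀ k n → Bell f k n ≈ Bell g k n
  Bell-cong f≈g zero zero = refl
  Bell-cong f≈g zero (suc n) = refl
  Bell-cong f≈g (suc k) zero = refl
  Bell-cong f≈g (suc k) (suc n) = ∑-cong n (λ j → *-cong refl (*-cong (f≈g (suc j)) (Bell-cong f≈g k (n ∸ j))))

  monomial : A → ℕ → Poly
  monomial a zero zero = a
  monomial a zero (suc m) = 0#
  monomial a (suc k) zero = 0#
  monomial a (suc k) (suc m) = monomial a k m

  monomial-diag : ∀ a k → monomial a k k ≡ a
  monomial-diag a zero = ≡.refl
  monomial-diag a (suc k) = monomial-diag a k

  monomial-≢ : ∀ a {k m} → k ≢ m → monomial a k m ≈ 0#
  monomial-≢ a {zero} {zero} 0≢0 = ⊥-elim (0≢0 ≡.refl)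
  monomial-≢ a {zero} {suc m} _ = refl
  monomial-≢ a {suc k} {zero} _ = refl
  monomial-≢ a {suc k} {suc m} k+1≢m+1 = monomial-≢ a (k+1≢m+1 ∘ ≡.cong suc)

  monomial-zero : ∀ k m → monomial 0# k m ≈ 0#
  monomial-zero zero zero = refl
  monomial-zero zero (suc m) = refl
  monomial-zero (suc k) zero = refl
  monomial-zero (suc k) (suc m) = monomial-zero k m

  *-monomial : ∀ x a k m → x * monomial a k m ≈ monomial (x * a) k m
  *-monomial x a zero zero = refl
  *-monomial x a zero (suc m) = zeroʳ x
  *-monomial x a (suc k) zero = zeroʳ x
  *-monomial x a (suc k) (suc m) = *-monomial x a k m

  ∑-monomial : ∀ n f k m → ∑[ j ≤ n ] monomial (f j) k m ≈ monomial (∑ n f) k m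
  ∑-monomial n f zero zero = refl
  ∑-monomial n f zero (suc m) = ∑-zero n (λ _ _ → refl)
  ∑-monomial n f (suc k) zero = ∑-zero n (λ _ _ → refl)
  ∑-monomial n f (suc k) (suc m) = ∑-monomial n f k m

  X*P-constP : ∀ a → (X *P constP a) ≈P monomial a 1
  X*P-constP a m = trans (*P-constP a X m) (a·X≈ax m)
    where
    a·X≈ax : ∀ m → a * X m ≈ monomial a 1 m
    a·X≈ax zero = zeroʳ a
    a·X≈ax (suc zero) = *-identityʳ a
    a·X≈ax (suc (suc m)) = zeroʳ a

  monomial-1-*P : ∀ a b k m → (monomial a 1 *P monomial b k) m ≈ monomial (a * b) (suc k) m
  monomial-1-*P a b k zero = zeroˡ _
  monomial-1-*P a b k (suc m) = begin
      ∑[ i ≤ suc m ] (monomial a 1 i * monomial b k (suc m ∸ i))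
    ≈⟨ ∑-suc m _ ⟩
      0# * monomial b k (suc m) + ∑[ i ≤ m ] (monomial a 0 i * monomial b k (m ∸ i))
    ≈⟨ trans (+-cong (zeroˡ _) refl) (+-identityˡ _) ⟩
      ∑[ i ≤ m ] (monomial a 0 i * monomial b k (m ∸ i))
    ≈⟨ ∑-head m (λ _ → zeroˡ _) ⟩
      a * monomial b k m
    ≈⟨ *-monomial a b k m ⟩
      monomial (a * b) k m ∎

  bellB-X*P : ∀ {ν g} → ν ≈ᶜ g → ∀ k n → bellB (λ n → X *P ν n) k n ≈P monomial (Bell g k n) k
  bellB-X*P ν≈g zero zero zero = refl
  bellB-X*P ν≈g zero zero (suc m) = refl
  bellB-X*P ν≈g zero (suc n) zero = refl
  bellB-X*P ν≈g zero (suc n) (suc m) = refl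
  bellB-X*P ν≈g (suc k) zero zero = refl
  bellB-X*P ν≈g (suc k) zero (suc m) = sym (monomial-zero k m)
  bellB-X*P {ν} {g} ν≈g (suc k) (suc n) m = begin
      sumP n (λ j → choose n j ·P (xν (suc j) *P bellB xν k (n ∸ j))) m
    ≈⟨ sumP-apply n _ m ⟩
      ∑[ j ≤ n ] (choose n j * (xν (suc j) *P bellB xν k (n ∸ j)) m)
    ≈⟨ ∑-cong n (λ j → *-cong refl (trans
         (*P-cong (λ i → trans (*P-cong {p = X} (λ _ → refl) (ν≈g (suc j)) i) (X*P-constP (g (suc j)) i))
                  (bellB-X*P ν≈g k (n ∸ j)) m)
         (monomial-1-*P _ _ k m))) ⟩
      ∑[ j ≤ n ] (choose n j * monomial (g (suc j) * Bell g k (n ∸ j)) (suc k) m)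
    ≈⟨ ∑-cong n (λ j → *-monomial _ _ (suc k) m) ⟩
      ∑[ j ≤ n ] monomial (choose n j * (g (suc j) * Bell g k (n ∸ j))) (suc k) m
    ≈⟨ ∑-monomial n _ (suc k) m ⟩
      monomial (Bell g (suc k) (suc n)) (suc k) m ∎
    where xν = λ n → X *P ν n

  expS-X*P : ∀ {ν g} → ν ≈ᶜ g → ∀ n m → expS (λ n → X *P ν n) n m ≈ Bell g m n
  expS-X*P {ν} {g} ν≈g n m = begin
      sumP n (λ k → 1P *P bellB xν k n) m
    ≈⟨ sumP-apply n _ m ⟩
      ∑[ k ≤ n ] (1P *P bellB xν k n) m
    ≈⟨ ∑-cong n (λ k → trans (constP-*P 1# (bellB xν k n) m) (trans (*-identityˡ _) (bellB-X*P ν≈g k n m))) ⟩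
      ∑[ k ≤ n ] monomial (Bell g k n) k m
    ≈⟨ pick (m ℕ.≤? n) ⟩
      Bell g m n ∎
    where
    xν = λ n → X *P ν n
    pick : Dec (m ℕ.≤ n) → ∑[ k ≤ n ] monomial (Bell g k n) k m ≈ Bell g m n
    pick (yes m≤n) = trans (∑-single n m m≤n (λ k _ k≢m → monomial-≢ (Bell g k n) k≢m)) (reflexive (monomial-diag _ m))
    pick (no m≰n) = trans (∑-zero n (λ k k≤n → monomial-≢ (Bell g k n) {k} {m} (λ { ≡.refl → m≰n k≤n })))
                          (sym (Bell-vanish g m n (ℕₚ.≰⇒> m≰n)))

  Bell-tˢ : ∀ k n → Bell tˢ k n ≈ monomial 1# n k
  Bell-tˢ zero zero = refl
  Bell-tˢ zero (suc n) = refl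
  Bell-tˢ (suc k) zero = refl
  Bell-tˢ (suc k) (suc n) = begin
      ∑[ j ≤ n ] (choose n j * (tˢ (suc j) * Bell tˢ k (n ∸ j)))
    ≈⟨ ∑-head n (λ _ → trans (*-cong refl (zeroˡ _)) (zeroʳ _)) ⟩
      choose n 0 * (1# * Bell tˢ k n)
    ≈⟨ trans (*-cong (choose-n-0 n) (*-identityˡ _)) (*-identityˡ _) ⟩
      Bell tˢ k n
    ≈⟨ Bell-tˢ k n ⟩
      monomial 1# n k ∎

  xu-monomial : ∀ n m → xu n m ≈ monomial 1# n m
  xu-monomial n m = begin
      xu n m
    ≈⟨ expS-X*P (logS-≈ᶜ (lift-≈ᶜ eᵗ)) n m ⟩
      Bell (logˢ eᵗ) m n
    ≈⟨ Bell-cong logˢ-eᵗ m n ⟩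
      Bell tˢ m n
    ≈⟨ Bell-tˢ m n ⟩
      monomial 1# n m ∎

  sumU-xu : ∀ {μ f} → μ ≈ᶜ f → ∀ j m → sumU μ xu j m ≈ choose j m * f (j ∸ m)
  sumU-xu {μ} {f} μ≈f j m = begin
      sumP j (λ i → choose j i ·P (μ i *P xu (j ∸ i))) m
    ≈⟨ sumP-apply j _ m ⟩
      ∑[ i ≤ j ] (choose j i * (μ i *P xu (j ∸ i)) m)
    ≈⟨ ∑-cong j (λ i → *-cong refl (trans (*P-cong (μ≈f i) (xu-monomial (j ∸ i)) m) (constP-*P (f i) (monomial 1# (j ∸ i)) m))) ⟩
      ∑[ i ≤ j ] (choose j i * (f i * monomial 1# (j ∸ i) m))
    ≈⟨ pick (m ℕ.≤? j) ⟩
      choose j m * f (j ∸ m) ∎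
    where
    term-≢ : ∀ i → j ∸ i ≢ m → choose j i * (f i * monomial 1# (j ∸ i) m) ≈ 0#
    term-≢ i j∸i≢m = trans (*-cong refl (trans (*-cong refl (monomial-≢ 1# j∸i≢m)) (zeroʳ _))) (zeroʳ _)
    pick : Dec (m ℕ.≤ j) → ∑[ i ≤ j ] (choose j i * (f i * monomial 1# (j ∸ i) m)) ≈ choose j m * f (j ∸ m)
    pick (yes m≤j) = begin
        ∑[ i ≤ j ] (choose j i * (f i * monomial 1# (j ∸ i) m))
      ≈⟨ ∑-single j (j ∸ m) (ℕₚ.m∸n≤m j m)
           (λ i i≤j i≢j∸m → term-≢ i (λ j∸i≡m → i≢j∸m (≡.trans (≡.sym (ℕₚ.m∸[m∸n]≡n i≤j)) (≡.cong (j ∸_) j∸i≡m)))) ⟩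
        choose j (j ∸ m) * (f (j ∸ m) * monomial 1# (j ∸ (j ∸ m)) m)
      ≡⟨ ≡.cong (λ i → choose j (j ∸ m) * (f (j ∸ m) * monomial 1# i m)) (ℕₚ.m∸[m∸n]≡n m≤j) ⟩
        choose j (j ∸ m) * (f (j ∸ m) * monomial 1# m m)
      ≈⟨ *-cong (natR-cong (≡.sym (nCk≡nC[n∸k] m≤j))) (trans (*-cong refl (reflexive (monomial-diag 1# m))) (*-identityʳ _)) ⟩
        choose j m * f (j ∸ m) ∎
    pick (no m≰j) = trans (∑-zero j (λ i i≤j → term-≢ i (λ j∸i≡m → m≰j (≡.subst (ℕ._≤ j) j∸i≡m (ℕₚ.m∸n≤m j i)))))
                          (sym (choose-vanish-* _ (ℕₚ.≰⇒> m≰j)))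

  sumU-xu-vanish : ∀ {μ f} → μ ≈ᶜ f → ∀ j m → j ℕ.< m → sumU μ xu j m ≈ 0#
  sumU-xu-vanish μ≈f j m j<m = trans (sumU-xu μ≈f j m) (choose-vanish-* _ j<m)

  choose-δ : ∀ j m → choose j m * δ (j ∸ m) ≈ monomial 1# j m
  choose-δ j m with j ℕ.≟ m
  ... | yes ≡.refl = begin
      choose j j * δ (j ∸ j)      ≡⟨ ≡.cong (λ i → choose j j * δ i) (ℕₚ.n∸n≡0 j) ⟩
      choose j j * 1#             ≈⟨ trans (*-identityʳ _) (choose-n-n j) ⟩
      1#                          ≡⟨ monomial-diag 1# j ⟨
      monomial 1# j j             ∎
  ... | no j≢m = trans (vanish (j ∸ m) ≡.refl) (sym (monomial-≢ 1# j≢m))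
    where
    vanish : ∀ r → j ∸ m ≡ r → choose j m * δ r ≈ 0#
    vanish zero j∸m≡0 =
      choose-vanish-* _ (ℕₚ.≤∧≢⇒< (ℕₚ.m∸n≡0⇒m≤n j∸m≡0) j≢m)
    vanish (suc r) _ = zeroʳ _

  -- Only k = m + i with i ≤ j - m contributes, and C(j, m + i) C(m + i, m) = C(j, m) C(j - m, i).
  binomial-⋆ : ∀ f g j m → ∑[ k ≤ j ] ((choose j k * f (j ∸ k)) * (choose k m * g (k ∸ m)))
                             ≈ choose j m * (g ⋆ f) (j ∸ m)
  binomial-⋆ f g j m with m ℕ.≤? j
  ... | no m≰j = trans (∑-zero j (λ k k≤j → trans (*-cong refl (choose-vanish-* _ (ℕₚ.≤-<-trans k≤j (ℕₚ.≰⇒> m≰j)))) (zeroʳ _)))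
                       (sym (choose-vanish-* _ (ℕₚ.≰⇒> m≰j)))
  ... | yes m≤j = begin
      ∑ j term
    ≡⟨ ≡.cong (λ n → ∑ n term) (ℕₚ.m+[n∸m]≡n m≤j) ⟨
      ∑ (m ℕ.+ r) term
    ≈⟨ ∑-skip m r (λ k k<m → trans (*-cong refl (choose-vanish-* _ k<m)) (zeroʳ _)) ⟩
      ∑[ i ≤ r ] term (m ℕ.+ i)
    ≈⟨ ∑-cong-≤ r reindexed ⟩
      ∑[ i ≤ r ] (choose j m * (choose r i * (g i * f (r ∸ i))))
    ≈⟨ *-distribˡ-∑ r _ _ ⟨
      choose j m * (g ⋆ f) r ∎
    where
    r = j ∸ m
    term = λ k → (choose j k * f (j ∸ k)) * (choose k m * g (k ∸ m))
    regroup : ∀ x u y v → (x * u) * (y * v) ≈ (x * y) * (v * u)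
    regroup x u y v = trans (*-assoc _ _ _)
      (trans (*-cong refl (trans (x∙yz≈y∙xz u y v) (*-cong refl (*-comm u v)))) (sym (*-assoc _ _ _)))
    reindexed : ∀ i → i ℕ.≤ r → term (m ℕ.+ i) ≈ choose j m * (choose r i * (g i * f (r ∸ i)))
    reindexed i i≤r = begin
        (choose j (m ℕ.+ i) * f (j ∸ (m ℕ.+ i))) * (choose (m ℕ.+ i) m * g (m ℕ.+ i ∸ m))
      ≈⟨ regroup _ _ _ _ ⟩
        (choose j (m ℕ.+ i) * choose (m ℕ.+ i) m) * (g (m ℕ.+ i ∸ m) * f (j ∸ (m ℕ.+ i)))
      ≈⟨ *-cong (trans (sym (natR-* (j C (m ℕ.+ i)) ((m ℕ.+ i) C m)))
                  (trans (natR-cong (nC[m+i]*[m+i]Cm≡nCm*[n∸m]Ci j m i m+i≤j)) (natR-* (j C m) (r C i))))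
                (*-cong (reflexive (≡.cong g (ℕₚ.m+n∸m≡n m i))) (reflexive (≡.cong f (≡.sym (ℕₚ.∸-+-assoc j m i))))) ⟩
        (choose j m * choose r i) * (g i * f (r ∸ i))
      ≈⟨ *-assoc _ _ _ ⟩
        choose j m * (choose r i * (g i * f (r ∸ i))) ∎
      where m+i≤j = ≡.subst (m ℕ.+ i ℕ.≤_) (ℕₚ.m+[n∸m]≡n m≤j) (ℕₚ.+-monoʳ-≤ m i≤r)

  -- Substituting ν + x.u into μ + x.u gives μ + ν + x.u, which is x.u when f(μ,t) f(ν,t) = 1.
  evalAt-sumU-xu : ∀ {μ f ν g} → μ ≈ᶜ f → ν ≈ᶜ g → (g ⋆ f) ≈ˢ δ → evalAt (sumU μ xu) (sumU ν xu) ≡ᵤ xu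
  evalAt-sumU-xu {μ} {f} {ν} {g} μ≈f ν≈g g⋆f≈δ j m = begin
      evalAt (sumU μ xu) (sumU ν xu) j m
    ≈⟨ sumP-apply j _ m ⟩
      ∑[ k ≤ j ] (sumU μ xu j k * sumU ν xu k m)
    ≈⟨ ∑-cong j (λ k → *-cong (sumU-xu μ≈f j k) (sumU-xu ν≈g k m)) ⟩
      ∑[ k ≤ j ] ((choose j k * f (j ∸ k)) * (choose k m * g (k ∸ m)))
    ≈⟨ binomial-⋆ f g j m ⟩
      choose j m * (g ⋆ f) (j ∸ m)
    ≈⟨ *-cong refl (g⋆f≈δ (j ∸ m)) ⟩
      choose j m * δ (j ∸ m)
    ≈⟨ choose-δ j m ⟩
      monomial 1# j m
    ≈⟨ xu-monomial j m ⟨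
      xu j m ∎

  evalAt-apply : ∀ s ζ n k → evalAt s ζ n k ≈ ∑[ j ≤ n ] (s n j * ζ j k)
  evalAt-apply s ζ n = sumP-apply n (λ j → s n j ·P ζ j)

  evalAt-congˡ : ∀ {s s′} ζ → s ≡ᵤ s′ → evalAt s ζ ≡ᵤ evalAt s′ ζ
  evalAt-congˡ {s} {s′} ζ s≡s′ n k =
    trans (evalAt-apply s ζ n k) (trans (∑-cong n (λ j → *-cong (s≡s′ n j) refl)) (sym (evalAt-apply s′ ζ n k)))

  evalAt-congʳ : ∀ s {ζ ζ′} → ζ ≡ᵤ ζ′ → evalAt s ζ ≡ᵤ evalAt s ζ′
  evalAt-congʳ s {ζ} {ζ′} ζ≡ζ′ n k =
    trans (evalAt-apply s ζ n k) (trans (∑-cong n (λ j → *-cong refl (ζ≡ζ′ j k))) (sym (evalAt-apply s ζ′ n k)))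

  -- evalAt truncates the n-th moment at degree n, so ζ must not have moments of higher degree.
  evalAt-assoc : ∀ s {ζ} η → (∀ j i → j ℕ.< i → ζ j i ≈ 0#) → evalAt (evalAt s ζ) η ≡ᵤ evalAt s (evalAt ζ η)
  evalAt-assoc s {ζ} η deg-ζ n k = begin
      evalAt (evalAt s ζ) η n k
    ≈⟨ evalAt-apply (evalAt s ζ) η n k ⟩
      ∑[ i ≤ n ] (evalAt s ζ n i * η i k)
    ≈⟨ ∑-cong n (λ i → trans (*-cong (evalAt-apply s ζ n i) refl)
                        (trans (*-distribʳ-∑ n _ _) (∑-cong n (λ j → *-assoc _ _ _)))) ⟩
      ∑[ i ≤ n ] ∑[ j ≤ n ] (s n j * (ζ j i * η i k))
    ≈⟨ ∑-comm n n _ ⟩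
      ∑[ j ≤ n ] ∑[ i ≤ n ] (s n j * (ζ j i * η i k))
    ≈⟨ ∑-cong-≤ n (λ j j≤n → trans (sym (*-distribˡ-∑ n _ _)) (*-cong refl
         (∑-truncate _ j≤n (λ i j<i _ → trans (*-cong (deg-ζ j i j<i) refl) (zeroˡ _))))) ⟩
      ∑[ j ≤ n ] (s n j * ∑[ i ≤ j ] (ζ j i * η i k))
    ≈⟨ ∑-cong n (λ j → *-cong refl (evalAt-apply ζ η j k)) ⟨
      ∑[ j ≤ n ] (s n j * evalAt ζ η j k)
    ≈⟨ evalAt-apply s (evalAt ζ η) n k ⟨
      evalAt s (evalAt ζ η) n k ∎

  evalAt-xu : ∀ {s} → (∀ n k → n ℕ.< k → s n k ≈ 0#) → evalAt s xu ≡ᵤ s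
  evalAt-xu {s} deg-s n k = begin
      evalAt s xu n k
    ≈⟨ evalAt-apply s xu n k ⟩
      ∑[ j ≤ n ] (s n j * xu j k)
    ≈⟨ ∑-cong n (λ j → *-cong refl (xu-monomial j k)) ⟩
      ∑[ j ≤ n ] (s n j * monomial 1# j k)
    ≈⟨ pick (k ℕ.≤? n) ⟩
      s n k ∎
    where
    term-≢ : ∀ j → j ≢ k → s n j * monomial 1# j k ≈ 0#
    term-≢ j j≢k = trans (*-cong refl (monomial-≢ 1# j≢k)) (zeroʳ _)
    pick : Dec (k ℕ.≤ n) → ∑[ j ≤ n ] (s n j * monomial 1# j k) ≈ s n k
    pick (yes k≤n) = trans (∑-single n k k≤n (λ j _ → term-≢ j))
                           (trans (*-cong refl (reflexive (monomial-diag 1# k))) (*-identityʳ _))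
    pick (no k≰n) = trans (∑-zero n (λ j j≤n → term-≢ j (λ { ≡.refl → k≰n j≤n })))
                          (sym (deg-s n k (ℕₚ.≰⇒> k≰n)))

  dotU-as-evalAt : ∀ ν {μ f} → μ ≈ᶜ f → dotU ν μ ≡ᵤ evalAt (dotScalar X μ) ν
  dotU-as-evalAt ν {μ} {f} μ≈f n k = begin
      sumP n (λ j → ν j *P bellB (logS μ) j n) k
    ≈⟨ sumP-apply n _ k ⟩
      ∑[ j ≤ n ] (ν j *P bellB (logS μ) j n) k
    ≈⟨ ∑-cong n (λ j → trans (*P-cong {p = ν j} (λ _ → refl) (bellB-≈ᶜ log-μ j n) k) (*P-constP _ (ν j) k)) ⟩
      ∑[ j ≤ n ] (Bell (logˢ f) j n * ν j k)
    ≈⟨ ∑-cong n (λ j → *-cong (expS-X*P log-μ n j) refl) ⟨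
      ∑[ j ≤ n ] (dotScalar X μ n j * ν j k)
    ≈⟨ evalAt-apply (dotScalar X μ) ν n k ⟨
      evalAt (dotScalar X μ) ν n k ∎
    where log-μ = logS-≈ᶜ μ≈f

  dotScalar-X-degree : ∀ {μ f} → μ ≈ᶜ f → ∀ n k → n ℕ.< k → dotScalar X μ n k ≈ 0#
  dotScalar-X-degree {f = f} μ≈f n k n<k = trans (expS-X*P (logS-≈ᶜ μ≈f) n k) (Bell-vanish (logˢ f) k n n<k)

  ≡ᵤ-setoid : Setoid c ℓ
  ≡ᵤ-setoid = record
    { Carrier = Seq
    ; _≈_ = _≡ᵤ_
    ; isEquivalence = record
      { refl = λ _ _ → refl
      ; sym = λ μ≡ν n k → sym (μ≡ν n k)
      ; trans = λ μ≡ν ν≡ρ n k → trans (μ≡ν n k) (ν≡ρ n k)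
      }
    }

theorem6p1 : ∀ {c ℓ} (R : CommutativeRing c ℓ) →
    Umbral.IsIntegralDomainChar0 R →
    (a g h : ℕ → CommutativeRing.Carrier R) (s : Umbral.Seq R) →
    Umbral.IsScalarUmbra R a →
    Umbral.IsScalarUmbra R g →
    Umbral.HasCompInverse R g h →
    Umbral.IsPolynomialUmbra R s →
    (Umbral.IsSheffer R a h s ⇔
      Umbral._≡ᵤ_ R (Umbral.evalAt R s (Umbral.sumU R (Umbral.lift R a) (Umbral.xu R)))
        (Umbral.associated R h))
theorem6p1 R _ a _ h s a₀ _ _ (_ , deg-s , _) = mk⇔ sheffer⇒associated associated⇒sheffer
  where
  open Umbral R
  open UmbralAlgebra R
  open CommutativeRing R using (trans)
  open import Relation.Binary.Reasoning.Setoid ≡ᵤ-setoid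

  W Z : Seq
  W = sumU (negU (lift a)) xu
  Z = sumU (lift a) xu

  W∘Z≡xu : evalAt W Z ≡ᵤ xu
  W∘Z≡xu = evalAt-sumU-xu (negU-≈ᶜ a) (lift-≈ᶜ a) (λ n → trans (⋆-comm n a (recipˢ a)) (recipˢ-inverseˡ a a₀ n))

  Z∘W≡xu : evalAt Z W ≡ᵤ xu
  Z∘W≡xu = evalAt-sumU-xu (lift-≈ᶜ a) (negU-≈ᶜ a) (recipˢ-inverseˡ a a₀)

  sheffer≡associated∘W : dotU W (gammaStar h) ≡ᵤ evalAt (associated h) W
  sheffer≡associated∘W = dotU-as-evalAt W (gammaStar-≈ᶜ h)

  sheffer⇒associated : IsSheffer a h s → evalAt s Z ≡ᵤ associated h
  sheffer⇒associated s≡ = begin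
    evalAt s Z                           ≈⟨ evalAt-congˡ Z s≡ ⟩
    evalAt (dotU W (gammaStar h)) Z      ≈⟨ evalAt-congˡ Z sheffer≡associated∘W ⟩
    evalAt (evalAt (associated h) W) Z   ≈⟨ evalAt-assoc (associated h) Z (sumU-xu-vanish (negU-≈ᶜ a)) ⟩
    evalAt (associated h) (evalAt W Z)   ≈⟨ evalAt-congʳ (associated h) W∘Z≡xu ⟩
    evalAt (associated h) xu             ≈⟨ evalAt-xu (dotScalar-X-degree (gammaStar-≈ᶜ h)) ⟩
    associated h                         ∎

  associated⇒sheffer : evalAt s Z ≡ᵤ associated h → IsSheffer a h s
  associated⇒sheffer s∘Z≡ = begin
    s                                    ≈⟨ evalAt-xu deg-s ⟨
    evalAt s xu                          ≈⟨ evalAt-congʳ s Z∘W≡xu ⟨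
    evalAt s (evalAt Z W)                ≈⟨ evalAt-assoc s W (sumU-xu-vanish (lift-≈ᶜ a)) ⟨
    evalAt (evalAt s Z) W                ≈⟨ evalAt-congˡ W s∘Z≡ ⟩
    evalAt (associated h) W              ≈⟨ sheffer≡associated∘W ⟨
    dotU W (gammaStar h)                 ∎
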